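{- Let $G=(V,E)$ be a graph with Gallai–Edmonds decomposition $\mathsf{GE}(G)=(C,A,D)$, and suppose $C\ne\varnothing$ and $D\ne\varnothing$. Let $G'$ be obtained from $G$ by adding an edge $\{u,v\}$ with $u\in C$ and $v\in D$. Then $\nu(G')=\nu(G)$.
   Context: $\nu(G)$ denotes the matching number of $G$. A vertex is essential in $G$ if it is covered by every maximum matching of $G$, and inessential otherwise. The Gallai–Edmonds decomposition $\mathsf{GE}(G)=(C,A,D)$ is defined by: $D$ is the set of inessential vertices, $A$ is the set of vertices in $V\setminus D$ adjacent to at least one vertex of $D$, and $C=V\setminus(D\cup A)$. -}

module Defs where

open import Data.Nat using (ℕ; _≤_)
open import Data.Fin using (Fin; _≟_)
open import Data.Product using (Σ; ∃; _×_; _,_; proj₁; proj₂)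
open import Data.Sum using (_⊎_; inj₁; inj₂)
open import Data.List using (List; []; _∷_; length; concatMap)
open import Data.List.Relation.Unary.All using (All)
open import Data.List.Relation.Unary.Unique.Propositional using (Unique)
open import Data.List.Membership.Propositional using (_∈_)
open import Relation.Nullary using (¬_; Dec; yes; no)
open import Relation.Nullary.Decidable using (_⊎-dec_; _×-dec_)
open import Relation.Binary.PropositionalEquality using (_≡_; subst)

record Graph (n : ℕ) : Set₁ where
  field
    Adj     : Fin n → Fin n → Set
    adj?    : ∀ x y → Dec (Adj x y)
    adj-sym    : ∀ {x y} → Adj x y → Adj y x
    adj-irrefl : ∀ {x} → ¬ Adj x x
open Graph public

Edge : ℕ → Set
Edge n = Fin n × Fin n

endpoints : ∀ {n} → List (Edge n) → List (Fin n)
endpoints = concatMap (λ e → proj₁ e ∷ proj₂ e ∷ [])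

record IsMatching {n} (G : Graph n) (M : List (Edge n)) : Set where
  field
    edges    : All (λ e → Adj G (proj₁ e) (proj₂ e)) M
    disjoint : Unique (endpoints M)

IsMaximumMatching : ∀ {n} → Graph n → List (Edge n) → Set
IsMaximumMatching G M =
  IsMatching G M × (∀ M' → IsMatching G M' → length M' ≤ length M)

MatchingNumber : ∀ {n} → Graph n → ℕ → Set
MatchingNumber G k = Σ _ λ M → IsMaximumMatching G M × length M ≡ k

Covers : ∀ {n} → List (Edge n) → Fin n → Set
Covers M v = v ∈ endpoints M

Essential : ∀ {n} → Graph n → Fin n → Set
Essential G v = ∀ M → IsMaximumMatching G M → Covers M v

InD : ∀ {n} → Graph n → Fin n → Set
InD G v = ¬ Essential G v

InA : ∀ {n} → Graph n → Fin n → Set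
InA G v = ¬ InD G v × ∃ λ w → InD G w × Adj G v w

InC : ∀ {n} → Graph n → Fin n → Set
InC G v = ¬ InD G v × ¬ InA G v

addEdge : ∀ {n} → Graph n → (u v : Fin n) → ¬ u ≡ v → Graph n
addEdge G u v u≢v = record
  { Adj    = λ x y → Adj G x y ⊎ ((x ≡ u × y ≡ v) ⊎ (x ≡ v × y ≡ u))
  ; adj?   = λ x y → adj? G x y ⊎-dec (((x ≟ u) ×-dec (y ≟ v)) ⊎-dec ((x ≟ v) ×-dec (y ≟ u)))
  ; adj-sym    = symm
  ; adj-irrefl = irr
  }
  where
  open import Relation.Binary.PropositionalEquality using (refl; trans; sym)
  R : Fin _ → Fin _ → Set
  R x y = Adj G x y ⊎ ((x ≡ u × y ≡ v) ⊎ (x ≡ v × y ≡ u))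
  symm : ∀ {x y} → R x y → R y x
  symm (inj₁ a) = inj₁ (adj-sym G a)
  symm (inj₂ (inj₁ (p , q))) = inj₂ (inj₂ (q , p))
  symm (inj₂ (inj₂ (p , q))) = inj₂ (inj₁ (q , p))
  irr : ∀ {x} → ¬ (Adj G x x ⊎ ((x ≡ u × x ≡ v) ⊎ (x ≡ v × x ≡ u)))
  irr (inj₁ a) = adj-irrefl G a
  irr (inj₂ (inj₁ (p , q))) = u≢v (trans (sym p) q)
  irr (inj₂ (inj₂ (p , q))) = u≢v (trans (sym q) p)

C≢D : ∀ {n} (G : Graph n) {u v : Fin n} → InC G u → InD G v → ¬ u ≡ v
C≢D G {u} uC vD u≡v = proj₁ uC (subst (λ w → InD G w) (Relation.Binary.PropositionalEquality.sym u≡v) vD)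
  where import Relation.Binary.PropositionalEquality

{-# OPTIONS --safe #-}
-- Deleting the edges at u from a matching of G + uv loses
-- at most one edge and leaves a matching of G that misses u. Since u is
-- essential, such a matching is not maximum in G, so it has fewer than ν(G)
-- edges and the original matching had at most ν(G).
module Submission where

open import Defs
open import Data.Nat using (ℕ; zero; suc; _≤_; _<_; z≤n; s≤s)
open import Data.Nat.Properties using (≤-trans; ≤-reflexive; ≤-pred; n≤1+n; ≤∧≢⇒<; suc-injective)
open import Data.Fin as Fin using (Fin; _≟_)
open import Data.Fin.Properties using (any?; injective⇒≤)
open import Data.Product using (Σ; ∃; _×_; _,_; proj₁)
open import Data.Sum using (inj₁; inj₂)
open import Data.List using (List; []; _∷_; length; lookup; filter)
open import Data.List.Properties using (filter-accept; filter-reject; filter-all)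
open import Data.List.Relation.Unary.All as All using (All; []; _∷_)
open import Data.List.Relation.Unary.All.Properties using (all-filter)
open import Data.List.Relation.Unary.AllPairs using ([]; _∷_)
open import Data.List.Relation.Unary.Any using (here; there)
open import Data.List.Relation.Unary.Unique.Propositional using (Unique)
import Data.List.Relation.Unary.Unique.DecPropositional as DecUnique
open import Data.List.Relation.Binary.Sublist.Propositional using (_⊆_; []; _∷_; _∷ʳ_)
open import Data.List.Relation.Binary.Sublist.Propositional.Properties using (All-resp-⊆; filter-⊆)
open import Data.List.Membership.Propositional.Properties using (∈-lookup)
open import Data.Empty using (⊥-elim)
open import Function using (_∘_)
open import Relation.Nullary using (¬_; Dec; yes; no; ¬?)
open import Relation.Nullary.Decidable using (map′; _×-dec_)
open import Relation.Binary.PropositionalEquality using (_≡_; refl; sym; subst; cong)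

private variable
  n : ℕ
  A B : Set
  G : Graph n
  x : Fin n
  M M₀ M₁ M₂ : List (Edge n)

Unique-resp-⊆ : {xs ys : List A} → xs ⊆ ys → Unique ys → Unique xs
Unique-resp-⊆ []             []           = []
Unique-resp-⊆ (_ ∷ʳ xs⊆ys)   (_ ∷ ys!)    = Unique-resp-⊆ xs⊆ys ys!
Unique-resp-⊆ (refl ∷ xs⊆ys) (y∉ys ∷ ys!) = All-resp-⊆ xs⊆ys y∉ys ∷ Unique-resp-⊆ xs⊆ys ys!

Unique⇒lookup-injective : {xs : List A} → Unique xs → ∀ {i j} → lookup xs i ≡ lookup xs j → i ≡ j
Unique⇒lookup-injective (_ ∷ _)    {Fin.zero}  {Fin.zero}  _  = refl
Unique⇒lookup-injective (x∉xs ∷ _) {Fin.zero}  {Fin.suc j} eq = ⊥-elim (All.lookup x∉xs (∈-lookup j) eq)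
Unique⇒lookup-injective (x∉xs ∷ _) {Fin.suc i} {Fin.zero}  eq = ⊥-elim (All.lookup x∉xs (∈-lookup i) (sym eq))
Unique⇒lookup-injective (_ ∷ xs!)  {Fin.suc i} {Fin.suc j} eq = cong Fin.suc (Unique⇒lookup-injective xs! eq)

Unique⇒length≤ : {xs : List (Fin n)} → Unique xs → length xs ≤ n
Unique⇒length≤ xs! = injective⇒≤ (Unique⇒lookup-injective xs!)

Exhaustible : Set → Set₁
Exhaustible A = {Q : A → Set} → (∀ a → Dec (Q a)) → Dec (∃ Q)

×-exhaustible : Exhaustible A → Exhaustible B → Exhaustible (A × B)
×-exhaustible ∃A? ∃B? Q? =
  map′ (λ (a , b , q) → (a , b) , q) (λ ((a , b) , q) → a , b , q)
       (∃A? λ a → ∃B? λ b → Q? (a , b))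

∃-ofLength? : Exhaustible A → ∀ m {P : List A → Set} → (∀ xs → Dec (P xs)) →
              Dec (∃ λ xs → length xs ≡ m × P xs)
∃-ofLength? ∃A? zero    P? =
  map′ (λ p → [] , refl , p) (λ { ([] , _ , p) → p ; (_ ∷ _ , () , _) }) (P? [])
∃-ofLength? ∃A? (suc m) P? =
  map′ (λ (x , xs , eq , p) → x ∷ xs , cong suc eq , p)
       (λ { (x ∷ xs , eq , p) → x , xs , suc-injective eq , p ; ([] , () , _) })
       (∃A? λ x → ∃-ofLength? ∃A? m λ xs → P? (x ∷ xs))

greatest : {P : ℕ → Set} → (∀ m → Dec (P m)) → P 0 → ∀ k → (∀ m → P m → m ≤ k) →
           ∃ λ m → P m × (∀ m′ → P m′ → m′ ≤ m)
greatest P? p₀ zero    bounded = 0 , p₀ , bounded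
greatest P? p₀ (suc k) bounded with P? (suc k)
... | yes p = suc k , p , bounded
... | no ¬p = greatest P? p₀ k λ m pm → ≤-pred (≤∧≢⇒< (bounded m pm) λ { refl → ¬p pm })

length≤length-endpoints : (M : List (Edge n)) → length M ≤ length (endpoints M)
length≤length-endpoints []      = z≤n
length≤length-endpoints (_ ∷ M) = s≤s (≤-trans (length≤length-endpoints M) (n≤1+n _))

IsMatching⇒length≤ : ∀ {n} {G : Graph n} {M} → IsMatching G M → length M ≤ n
IsMatching⇒length≤ {M = M} isM =
  ≤-trans (length≤length-endpoints M) (Unique⇒length≤ (IsMatching.disjoint isM))

[]-isMatching : IsMatching G []
[]-isMatching = record { edges = [] ; disjoint = [] }

isMatching? : (G : Graph n) → ∀ M → Dec (IsMatching G M)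
isMatching? G M =
  map′ (λ (e , d) → record { edges = e ; disjoint = d })
       (λ isM → IsMatching.edges isM , IsMatching.disjoint isM)
       (All.all? (λ (a , b) → adj? G a b) M ×-dec DecUnique.unique? _≟_ (endpoints M))

maximumMatching : (G : Graph n) → ∃ (IsMaximumMatching G)
maximumMatching {n} G
  with greatest (λ m → ∃-ofLength? (×-exhaustible any? any?) m (isMatching? G))
                ([] , refl , []-isMatching) n
                (λ { _ (_ , refl , isM) → IsMatching⇒length≤ isM })
... | _ , (M , refl , isM) , longest = M , isM , λ M′ isM′ → longest _ (M′ , refl , isM′)

endpoints-⊆ : M₁ ⊆ M₂ → endpoints M₁ ⊆ endpoints M₂
endpoints-⊆ []                 = []
endpoints-⊆ ((a , b) ∷ʳ M₁⊆M₂) = a ∷ʳ b ∷ʳ endpoints-⊆ M₁⊆M₂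
endpoints-⊆ (refl ∷ M₁⊆M₂)     = refl ∷ refl ∷ endpoints-⊆ M₁⊆M₂

IsMatching-resp-⊆ : M₁ ⊆ M₂ → IsMatching G M₂ → IsMatching G M₁
IsMatching-resp-⊆ M₁⊆M₂ isM = record
  { edges    = All-resp-⊆ M₁⊆M₂ (IsMatching.edges isM)
  ; disjoint = Unique-resp-⊆ (endpoints-⊆ M₁⊆M₂) (IsMatching.disjoint isM)
  }

Avoids : Fin n → Edge n → Set
Avoids x (a , b) = ¬ x ≡ a × ¬ x ≡ b

avoids? : (x : Fin n) → ∀ e → Dec (Avoids x e)
avoids? x (a , b) = ¬? (x ≟ a) ×-dec ¬? (x ≟ b)

All-Avoids⇒¬Covers : All (Avoids x) M → ¬ Covers M x
All-Avoids⇒¬Covers ((x≢a , _) ∷ _) (here x≡a)         = x≢a x≡a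
All-Avoids⇒¬Covers ((_ , x≢b) ∷ _) (there (here x≡b)) = x≢b x≡b
All-Avoids⇒¬Covers (_ ∷ avoids)    (there (there x∈M)) = All-Avoids⇒¬Covers avoids x∈M

¬Covers⇒All-Avoids : ∀ M → ¬ Covers M x → All (Avoids x) M
¬Covers⇒All-Avoids []      _    = []
¬Covers⇒All-Avoids (_ ∷ M) x∉M =
  (x∉M ∘ here , x∉M ∘ there ∘ here) ∷ ¬Covers⇒All-Avoids M (x∉M ∘ there ∘ there)

_∖_ : List (Edge n) → Fin n → List (Edge n)
M ∖ x = filter (avoids? x) M

∖-uncovers : ∀ M → ¬ Covers (M ∖ x) x
∖-uncovers {x = x} M = All-Avoids⇒¬Covers (all-filter (avoids? x) M)

-- Edges of a matching are disjoint, so at most one of them meets x.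
length-∖ : ∀ M → Unique (endpoints M) → length M ≤ suc (length (M ∖ x))
length-∖ []            _ = z≤n
length-∖ {x = x} ((a , b) ∷ M) (a∉ ∷ b∉ ∷ M!) with avoids? x (a , b)
... | yes av  rewrite filter-accept (avoids? x) {xs = M} av = s≤s (length-∖ M M!)
... | no  ¬av rewrite filter-reject (avoids? x) {xs = M} ¬av =
  s≤s (≤-reflexive (cong length (sym (filter-all (avoids? x) avoidsAll))))
  where
  avoidsAll : All (Avoids x) M
  avoidsAll = ¬Covers⇒All-Avoids M λ x∈M →
    ¬av ((λ { refl → All.lookup (All.tail a∉) x∈M refl }) , (λ { refl → All.lookup b∉ x∈M refl }))

module _ (G : Graph n) {u v : Fin n} (u≢v : ¬ u ≡ v) where

  addEdge-isMatching : IsMatching G M → IsMatching (addEdge G u v u≢v) M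
  addEdge-isMatching isM = record
    { edges    = All.map inj₁ (IsMatching.edges isM)
    ; disjoint = IsMatching.disjoint isM
    }

  addEdge-Adj-avoiding : ∀ {a b} → Adj (addEdge G u v u≢v) a b → Avoids u (a , b) → Adj G a b
  addEdge-Adj-avoiding (inj₁ ab)                  _         = ab
  addEdge-Adj-avoiding (inj₂ (inj₁ (refl , _)))  (u≢u , _) = ⊥-elim (u≢u refl)
  addEdge-Adj-avoiding (inj₂ (inj₂ (_ , refl)))  (_ , u≢u) = ⊥-elim (u≢u refl)

  addEdge-∖-isMatching : IsMatching (addEdge G u v u≢v) M → IsMatching G (M ∖ u)
  addEdge-∖-isMatching {M = M} isM = record
    { edges    = All.zipWith (λ (ab , av) → addEdge-Adj-avoiding ab av)
                   (IsMatching.edges isM∖u , all-filter (avoids? u) M)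
    ; disjoint = IsMatching.disjoint isM∖u
    }
    where
    isM∖u : IsMatching (addEdge G u v u≢v) (M ∖ u)
    isM∖u = IsMatching-resp-⊆ (filter-⊆ (avoids? u) M) isM

uncovered⇒shorter : ∀ {u} → ¬ InD G u → IsMaximumMatching G M → IsMatching G M₀ → ¬ Covers M₀ u →
                    length M₀ < length M
uncovered⇒shorter u∉D (_ , maximal) isM₀ u∉M₀ = ≤∧≢⇒< (maximal _ isM₀) λ sameLength →
  u∉D λ essential → u∉M₀ (essential _ (isM₀ , λ M′ isM′ →
    subst (length M′ ≤_) (sym sameLength) (maximal M′ isM′)))

addEdge-isMaximumMatching : (G : Graph n) {u v : Fin n} (u≢v : ¬ u ≡ v) → ¬ InD G u →
                            IsMaximumMatching G M → IsMaximumMatching (addEdge G u v u≢v) M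
addEdge-isMaximumMatching G u≢v u∉D maxM@(isM , _) =
  addEdge-isMatching G u≢v isM , λ M′ isM′ →
    ≤-trans (length-∖ M′ (IsMatching.disjoint isM′))
            (uncovered⇒shorter u∉D maxM (addEdge-∖-isMatching G u≢v isM′) (∖-uncovers M′))

lemma2p3 : ∀ {n} (G : Graph n)
    → (∃ λ c → InC G c)
    → (∃ λ d → InD G d)
    → (u v : Fin n) → (uC : InC G u) → (vD : InD G v)
    → Σ ℕ λ k → MatchingNumber G k × MatchingNumber (addEdge G u v (C≢D G uC vD)) k
lemma2p3 G _ _ u v uC vD =
  let M , maxM = maximumMatching G
      maxM′ = addEdge-isMaximumMatching G (C≢D G uC vD) (proj₁ uC) maxM
  in  length M , (M , maxM , refl) , (M , maxM′ , refl)
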